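{- For every positive integer $n$, $$\sum_{\substack{\pi\in\mathfrak{B}_n^+\\ \mathsf{pos}_n(\pi)\neq n}}t^{\mathsf{des}_B(\pi)}s^{\mathsf{asc}_B(\pi)}=\sum_{\substack{\pi\in\mathfrak{B}_n^-\\ \mathsf{pos}_n(\pi)\neq n}}t^{\mathsf{des}_B(\pi)}s^{\mathsf{asc}_B(\pi)}=\frac12\sum_{\substack{\pi\in\mathfrak{B}_n\\ \mathsf{pos}_n(\pi)\neq n}}t^{\mathsf{des}_B(\pi)}s^{\mathsf{asc}_B(\pi)}.$$
   Context: $\mathfrak{B}_n$ is the group of signed permutations: bijections $\pi$ of $\{\pm1,\dots,\pm n\}$ with $\pi(-i)=-\pi(i)$; write $\pi_i=\pi(i)$ and $\pi_0=0$. $\mathsf{inv}_B(\pi)=|\{1\le i<j\le n:\pi_i>\pi_j\}|+|\{1\le i<j\le n:-\pi_i>\pi_j\}|+|\{i\in[n]:\pi_i<0\}|$; $\mathfrak{B}_n^+$ is the set of $\pi$ with $\mathsf{inv}_B(\pi)$ even and $\mathfrak{B}_n^-=\mathfrak{B}_n\setminus\mathfrak{B}_n^+$. $\mathsf{des}_B(\pi)=|\{i\in\{0,\dots,n-1\}:\pi_i>\pi_{i+1}\}|$, $\mathsf{asc}_B(\pi)=|\{i\in\{0,\dots,n-1\}:\pi_i<\pi_{i+1}\}|$. $\mathsf{pos}_n(\pi)$ is the index $k$ with $|\pi_k|=n$. -}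

module Defs where

open import Data.Nat using (ℕ; zero; suc; _+_; _*_; _≡ᵇ_)
open import Data.Integer as ℤ using (ℤ; +_; -_; ∣_∣; _<?_)
open import Relation.Nullary.Decidable using (does)
open import Data.Bool using (Bool; true; false; if_then_else_; _∧_; not)
open import Data.List using (List; []; _∷_; map; concatMap; filterᵇ; foldr; length; upTo; sum)
open import Relation.Binary.PropositionalEquality using (_≡_)

-- Signed permutations of [n] are represented in one-line notation as the word
-- (π_1, …, π_n) ∈ ℤⁿ, i.e. as lists of integers of length n.

signedValues : ℕ → List ℤ
signedValues n = concatMap (λ i → (+ suc i) ∷ (- (+ suc i)) ∷ []) (upTo n)

words : {A : Set} → List A → ℕ → List (List A)
words A zero = [] ∷ []
words A (suc k) = concatMap (λ w → map (λ a → a ∷ w) A) (words A k)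

elemᵇ : ℕ → List ℕ → Bool
elemᵇ x [] = false
elemᵇ x (y ∷ ys) = if x ≡ᵇ y then true else elemᵇ x ys

distinctᵇ : List ℕ → Bool
distinctᵇ [] = true
distinctᵇ (x ∷ xs) = not (elemᵇ x xs) ∧ distinctᵇ xs

-- a word over {±1,…,±n} of length n is a signed permutation iff the absolute
-- values |π_1|, …, |π_n| are pairwise distinct.
-- 𝔅ₙ : the list of all signed permutations of [n] (each exactly once).
B : ℕ → List (List ℤ)
B n = filterᵇ (λ w → distinctᵇ (map ∣_∣ w)) (words (signedValues n) n)

infix 4 _<ᵇ_
_<ᵇ_ : ℤ → ℤ → Bool
x <ᵇ y = does (x <? y)

count : {A : Set} → (A → Bool) → List A → ℕ
count p [] = 0
count p (x ∷ xs) = (if p x then 1 else 0) + count p xs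

pairInv : List ℤ → ℕ
pairInv [] = 0
pairInv (x ∷ xs) = count (λ y → y <ᵇ x) xs + count (λ y → y <ᵇ (- x)) xs + pairInv xs

invB : List ℤ → ℕ
invB π = pairInv π + count (λ x → x <ᵇ (+ 0)) π

evenᵇ : ℕ → Bool
evenᵇ zero = true
evenᵇ (suc zero) = false
evenᵇ (suc (suc n)) = evenᵇ n

desW : List ℤ → ℕ
desW [] = 0
desW (x ∷ []) = 0
desW (x ∷ y ∷ ys) = (if (y <ᵇ x) then 1 else 0) + desW (y ∷ ys)

ascW : List ℤ → ℕ
ascW [] = 0
ascW (x ∷ []) = 0
ascW (x ∷ y ∷ ys) = (if (x <ᵇ y) then 1 else 0) + ascW (y ∷ ys)

-- des_B, asc_B use positions 0,…,n-1 with π_0 = 0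
desB : List ℤ → ℕ
desB π = desW (+ 0 ∷ π)

ascB : List ℤ → ℕ
ascB π = ascW (+ 0 ∷ π)

-- pos_n(π): the (1-based) index k with |π_k| = n  (0 if no such index)
posAux : ℕ → ℕ → List ℤ → ℕ
posAux n k [] = 0
posAux n k (x ∷ xs) = if ∣ x ∣ ≡ᵇ n then k else posAux n (suc k) xs

pos : ℕ → List ℤ → ℕ
pos n π = posAux n 1 π

-- Bivariate polynomials in t, s with ℕ coefficients, given by their
-- coefficient function: P i j = coefficient of t^i s^j.
Poly2 : Set
Poly2 = ℕ → ℕ → ℕ

monomial : ℕ → ℕ → Poly2
monomial a b i j = if (a ≡ᵇ i) ∧ (b ≡ᵇ j) then 1 else 0

_⊕_ : Poly2 → Poly2 → Poly2
(P ⊕ Q) i j = P i j + Q i j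

zeroP : Poly2
zeroP i j = 0

infixl 7 _·_
_·_ : ℕ → Poly2 → Poly2
(c · P) i j = c * P i j

desAscGF : (List ℤ → Bool) → List (List ℤ) → Poly2
desAscGF φ [] = zeroP
desAscGF φ (π ∷ S) = (if φ π then monomial (desB π) (ascB π) else zeroP) ⊕ desAscGF φ S

infix 4 _≈P_
_≈P_ : Poly2 → Poly2 → Set
P ≈P Q = ∀ i j → P i j ≡ Q i j

plusCond : ℕ → List ℤ → Bool
plusCond n π = evenᵇ (invB π) ∧ not (pos n π ≡ᵇ n)

minusCond : ℕ → List ℤ → Bool
minusCond n π = not (evenᵇ (invB π)) ∧ not (pos n π ≡ᵇ n)

allCond : ℕ → List ℤ → Bool
allCond n π = not (pos n π ≡ᵇ n)

-- Let σ negate the entry of absolute value n.  It permutes 𝔅ₙ and fixes pos_n.  If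
-- pos_n(π) < n, the entry ±n sits between two entries of absolute value < n (the
-- left one possibly π₀ = 0), and n and -n compare the same way with all of them, so
-- σ preserves des_B and asc_B; while negating the entry n in position k changes
-- inv_B by 2k - 1, so σ swaps 𝔅ₙ⁺ and 𝔅ₙ⁻.  Hence the 𝔅ₙ⁺ and 𝔅ₙ⁻ sums agree, and
-- together they make up the 𝔅ₙ sum.
module Submission where

open import Defs
open import Data.Nat using (ℕ; zero; suc; _+_; _*_; _≤_; z≤n; s≤s; z<s; _≡ᵇ_)
import Data.Nat.Properties as ℕP
open import Data.Nat.Solver using (module +-*-Solver)
open import Data.Integer as ℤ using (ℤ; -[1+_]; -_; ∣_∣; -<-; -<+; +<+) renaming (+_ to ⁺_)
import Data.Integer.Properties as ℤP
open import Data.Bool using (Bool; true; false; if_then_else_; not; T)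
open import Data.Bool.Properties using (∧-zeroʳ; not-involutive)
open import Data.Unit using (tt)
open import Data.List using (List; []; _∷_; _++_; map; concatMap; filterᵇ; length; upTo)
open import Data.List.Properties using (map-++; map-id; map-∘; map-cong; map-cong-local; length-map; length-++)
open import Data.List.Relation.Unary.All as All using (All; []; _∷_)
open import Data.List.Relation.Unary.All.Properties using (++⁻ˡ; ++⁻ʳ; concat⁺; map⁺; applyUpTo⁺₁)
open import Data.Product using (_×_; _,_; proj₂)
open import Data.Empty using (⊥-elim)
open import Function using (_∘_; id)
open import Relation.Nullary using (¬_)
open import Relation.Nullary.Decidable using (dec-true; dec-false)
open import Relation.Binary.PropositionalEquality
open import Algebra.Properties.CommutativeSemigroup ℕP.+-commutativeSemigroup using (interchange)

≡ᵇ-true⇒≡ : ∀ {a b} → (a ≡ᵇ b) ≡ true → a ≡ b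
≡ᵇ-true⇒≡ {a} {b} eq = ℕP.≡ᵇ⇒≡ a b (subst T (sym eq) tt)

≡⇒≡ᵇ-true : ∀ {a b} → a ≡ b → (a ≡ᵇ b) ≡ true
≡⇒≡ᵇ-true {a} {b} a≡b with a ≡ᵇ b | ℕP.≡⇒≡ᵇ a b a≡b
... | true | _ = refl

≡ᵇ-false⇒≢ : ∀ {a b} → (a ≡ᵇ b) ≡ false → a ≢ b
≡ᵇ-false⇒≢ {a} {b} eq a≡b = subst T eq (ℕP.≡⇒≡ᵇ a b a≡b)

≢⇒≡ᵇ-false : ∀ {a b} → a ≢ b → (a ≡ᵇ b) ≡ false
≢⇒≡ᵇ-false {a} {b} a≢b with a ≡ᵇ b in eq
... | true = ⊥-elim (a≢b (≡ᵇ-true⇒≡ eq))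
... | false = refl

evenᵇ-suc : ∀ k → evenᵇ (suc k) ≡ not (evenᵇ k)
evenᵇ-suc zero = refl
evenᵇ-suc (suc k) = trans (sym (not-involutive (evenᵇ k))) (cong not (sym (evenᵇ-suc k)))

evenᵇ-2*+ : ∀ l k → evenᵇ (2 * l + k) ≡ evenᵇ k
evenᵇ-2*+ zero k = refl
evenᵇ-2*+ (suc l) k = trans (cong (λ z → evenᵇ (z + k)) (ℕP.*-suc 2 l)) (evenᵇ-2*+ l k)

evenᵇ-1+2*+ : ∀ l k → evenᵇ (suc (2 * l + k)) ≡ not (evenᵇ k)
evenᵇ-1+2*+ l k = trans (evenᵇ-suc (2 * l + k)) (cong not (evenᵇ-2*+ l k))

∑ : {A : Set} → List A → (A → ℕ) → ℕ
∑ [] f = 0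
∑ (x ∷ xs) f = f x + ∑ xs f

∑-cong : {A : Set} (xs : List A) {f g : A → ℕ} → (∀ x → f x ≡ g x) → ∑ xs f ≡ ∑ xs g
∑-cong [] f≗g = refl
∑-cong (x ∷ xs) f≗g = cong₂ _+_ (f≗g x) (∑-cong xs f≗g)

∑-cong-local : {A : Set} {xs : List A} {f g : A → ℕ} → All (λ x → f x ≡ g x) xs → ∑ xs f ≡ ∑ xs g
∑-cong-local [] = refl
∑-cong-local (fx≡gx ∷ eqs) = cong₂ _+_ fx≡gx (∑-cong-local eqs)

∑-++ : {A : Set} (xs ys : List A) (f : A → ℕ) → ∑ (xs ++ ys) f ≡ ∑ xs f + ∑ ys f
∑-++ [] ys f = refl
∑-++ (x ∷ xs) ys f = trans (cong (f x +_) (∑-++ xs ys f)) (sym (ℕP.+-assoc (f x) _ _))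

∑-map : {A B : Set} (xs : List A) (h : A → B) (f : B → ℕ) → ∑ (map h xs) f ≡ ∑ xs (f ∘ h)
∑-map [] h f = refl
∑-map (x ∷ xs) h f = cong (f (h x) +_) (∑-map xs h f)

∑-concatMap : {A B : Set} (xs : List A) (g : A → List B) (f : B → ℕ) →
  ∑ (concatMap g xs) f ≡ ∑ xs (λ x → ∑ (g x) f)
∑-concatMap [] g f = refl
∑-concatMap (x ∷ xs) g f = trans (∑-++ (g x) (concatMap g xs) f) (cong (∑ (g x) f +_) (∑-concatMap xs g f))

∑-filterᵇ : {A : Set} (p : A → Bool) (xs : List A) (f : A → ℕ) →
  ∑ (filterᵇ p xs) f ≡ ∑ xs (λ x → if p x then f x else 0)
∑-filterᵇ p [] f = refl
∑-filterᵇ p (x ∷ xs) f with p x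
... | true = cong (f x +_) (∑-filterᵇ p xs f)
... | false = ∑-filterᵇ p xs f

∑-words-suc : {A : Set} (as : List A) (k : ℕ) (F : List A → ℕ) →
  ∑ (words as (suc k)) F ≡ ∑ (words as k) (λ w → ∑ as (λ a → F (a ∷ w)))
∑-words-suc as k F =
  trans (∑-concatMap (words as k) _ F) (∑-cong (words as k) (λ w → ∑-map as (λ a → a ∷ w) F))

∑-words-map : {A : Set} (as : List A) (σ : A → A) → (∀ (H : A → ℕ) → ∑ as (H ∘ σ) ≡ ∑ as H) →
  ∀ k (F : List A → ℕ) → ∑ (words as k) (F ∘ map σ) ≡ ∑ (words as k) F
∑-words-map as σ σ-invariant zero F = refl
∑-words-map as σ σ-invariant (suc k) F = begin
  ∑ (words as (suc k)) (F ∘ map σ)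
    ≡⟨ ∑-words-suc as k (F ∘ map σ) ⟩
  ∑ (words as k) (λ w → ∑ as (λ a → F (σ a ∷ map σ w)))
    ≡⟨ ∑-cong (words as k) (λ w → σ-invariant (λ b → F (b ∷ map σ w))) ⟩
  ∑ (words as k) (λ w → ∑ as (λ a → F (a ∷ map σ w)))
    ≡⟨ ∑-words-map as σ σ-invariant k (λ w → ∑ as (λ a → F (a ∷ w))) ⟩
  ∑ (words as k) (λ w → ∑ as (λ a → F (a ∷ w)))
    ≡⟨ ∑-words-suc as k F ⟨
  ∑ (words as (suc k)) F ∎
  where open ≡-Reasoning

∑-words-cong : {A : Set} {P : A → Set} (as : List A) → All P as → ∀ k {F G : List A → ℕ} →
  (∀ w → All P w → length w ≡ k → F w ≡ G w) → ∑ (words as k) F ≡ ∑ (words as k) G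
∑-words-cong as Pas zero F≗G = cong (_+ 0) (F≗G [] [] refl)
∑-words-cong as Pas (suc k) {F} {G} F≗G =
  trans (∑-words-suc as k F) (trans
    (∑-words-cong as Pas k (λ w Pw |w| →
      ∑-cong-local (All.map (λ {a} Pa → F≗G (a ∷ w) (Pa ∷ Pw) (cong suc |w|)) Pas)))
    (sym (∑-words-suc as k G)))

_∈[1,_] : ℕ → ℕ → Set
x ∈[1, k ] = 1 ≤ x × x ≤ k

remove : ℕ → List ℕ → List ℕ
remove k [] = []
remove k (x ∷ xs) = if k ≡ᵇ x then remove k xs else x ∷ remove k xs

elemᵇ-remove : ∀ x k xs → elemᵇ x xs ≡ false → elemᵇ x (remove k xs) ≡ false
elemᵇ-remove x k [] x∉xs = refl
elemᵇ-remove x k (y ∷ ys) x∉xs with x ≡ᵇ y in x≟y | k ≡ᵇ y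
elemᵇ-remove x k (y ∷ ys) () | true | _
... | false | true = elemᵇ-remove x k ys x∉xs
... | false | false rewrite x≟y = elemᵇ-remove x k ys x∉xs

distinctᵇ-remove : ∀ k xs → distinctᵇ xs ≡ true → distinctᵇ (remove k xs) ≡ true
distinctᵇ-remove k [] _ = refl
distinctᵇ-remove k (x ∷ xs) dist with elemᵇ x xs in x∉xs | k ≡ᵇ x
distinctᵇ-remove k (x ∷ xs) () | true | _
... | false | true = distinctᵇ-remove k xs dist
... | false | false rewrite elemᵇ-remove x k xs x∉xs = distinctᵇ-remove k xs dist

remove-∉ : ∀ k xs → elemᵇ k xs ≡ false → remove k xs ≡ xs
remove-∉ k [] _ = refl
remove-∉ k (y ∷ ys) k∉ys with k ≡ᵇ y
remove-∉ k (y ∷ ys) () | true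
... | false = cong (y ∷_) (remove-∉ k ys k∉ys)

length-remove : ∀ k xs → distinctᵇ xs ≡ true → length xs ≤ suc (length (remove k xs))
length-remove k [] _ = z≤n
length-remove k (x ∷ xs) dist with elemᵇ x xs in x∉xs | k ≡ᵇ x in k≟x
length-remove k (x ∷ xs) () | true | _
... | false | true = ℕP.≤-reflexive (cong (suc ∘ length) (sym (remove-∉ k xs k∉xs)))
  where
  k∉xs : elemᵇ k xs ≡ false
  k∉xs = subst (λ z → elemᵇ z xs ≡ false) (sym (≡ᵇ-true⇒≡ k≟x)) x∉xs
... | false | false = s≤s (length-remove k xs dist)

remove-max : ∀ k xs → All (_∈[1, suc k ]) xs → All (_∈[1, k ]) (remove (suc k) xs)
remove-max k [] _ = []
remove-max k (x ∷ xs) ((1≤x , x≤1+k) ∷ rest) with suc k ≡ᵇ x in k+1≟x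
... | true = remove-max k xs rest
... | false = (1≤x , ℕP.≤-pred (ℕP.≤∧≢⇒< x≤1+k (≡ᵇ-false⇒≢ k+1≟x ∘ sym))) ∷ remove-max k xs rest

distinct-length-≤ : ∀ k xs → distinctᵇ xs ≡ true → All (_∈[1, k ]) xs → length xs ≤ k
distinct-length-≤ zero [] _ _ = z≤n
distinct-length-≤ zero (x ∷ xs) _ ((1≤x , x≤0) ∷ _) = ⊥-elim (ℕP.<⇒≱ 1≤x x≤0)
distinct-length-≤ (suc k) xs dist bounds = ℕP.≤-trans (length-remove (suc k) xs dist)
  (s≤s (distinct-length-≤ k (remove (suc k) xs) (distinctᵇ-remove (suc k) xs dist) (remove-max k xs bounds)))

distinctᵇ-after : ∀ xs y ys → distinctᵇ (xs ++ y ∷ ys) ≡ true → elemᵇ y ys ≡ false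
distinctᵇ-after [] y ys dist with elemᵇ y ys
distinctᵇ-after [] y ys () | true
... | false = refl
distinctᵇ-after (x ∷ xs) y ys dist with elemᵇ x (xs ++ y ∷ ys)
distinctᵇ-after (x ∷ xs) y ys () | true
... | false = distinctᵇ-after xs y ys dist

<⇒<ᵇ-true : ∀ {a b} → a ℤ.< b → (a <ᵇ b) ≡ true
<⇒<ᵇ-true {a} {b} a<b = dec-true (a ℤ.<? b) a<b

>⇒<ᵇ-false : ∀ {a b} → b ℤ.< a → (a <ᵇ b) ≡ false
>⇒<ᵇ-false {a} {b} b<a = dec-false (a ℤ.<? b) (ℤP.<-asym b<a)

count-replace : {A : Set} (p : A → Bool) (pre post : List A) {a b : A} → p a ≡ true → p b ≡ false →
  count p (pre ++ a ∷ post) ≡ suc (count p (pre ++ b ∷ post))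
count-replace p [] post pa pb rewrite pa | pb = refl
count-replace p (x ∷ pre) post pa pb =
  trans (cong ((if p x then 1 else 0) +_) (count-replace p pre post pa pb)) (ℕP.+-suc _ _)

module ExtremeLetter (m : ℕ) where

  Small : ℤ → Set
  Small y = ∣ y ∣ ≤ m

  -[1+m]<small : ∀ y → Small y → -[1+ m ] ℤ.< y
  -[1+m]<small (⁺ k) _ = -<+
  -[1+m]<small -[1+ k ] 1+k≤m = -<- 1+k≤m

  small<+[1+m] : ∀ y → Small y → y ℤ.< ⁺ suc m
  small<+[1+m] (⁺ k) k≤m = +<+ (s≤s k≤m)
  small<+[1+m] -[1+ k ] _ = -<+

  small-neg : ∀ y → Small y → Small (- y)
  small-neg y = subst (_≤ m) (sym (ℤP.∣-i∣≡∣i∣ y))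

  pairInv-negate-extreme : ∀ pre post → All Small pre →
    pairInv (pre ++ -[1+ m ] ∷ post) ≡ 2 * length pre + pairInv (pre ++ ⁺ suc m ∷ post)
  pairInv-negate-extreme [] post [] =
    cong (_+ pairInv post) (ℕP.+-comm (count (λ y → y <ᵇ -[1+ m ]) post) (count (λ y → y <ᵇ ⁺ suc m) post))
  pairInv-negate-extreme (x ∷ pre) post (sx ∷ spre)
    rewrite count-replace (λ y → y <ᵇ x) pre post { -[1+ m ]} {⁺ suc m}
              (<⇒<ᵇ-true (-[1+m]<small x sx)) (>⇒<ᵇ-false (small<+[1+m] x sx))
          | count-replace (λ y → y <ᵇ - x) pre post { -[1+ m ]} {⁺ suc m}
              (<⇒<ᵇ-true (-[1+m]<small (- x) (small-neg x sx))) (>⇒<ᵇ-false (small<+[1+m] (- x) (small-neg x sx)))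
          | pairInv-negate-extreme pre post spre
    = rearrange (count (λ y → y <ᵇ x) rest) (count (λ y → y <ᵇ - x) rest) (length pre) (pairInv rest)
    where
    rest = pre ++ ⁺ suc m ∷ post
    open +-*-Solver
    rearrange : ∀ a b l p → suc a + suc b + (2 * l + p) ≡ 2 * suc l + (a + b + p)
    rearrange = solve 4 (λ a b l p → (con 1 :+ a) :+ (con 1 :+ b) :+ (con 2 :* l :+ p)
                                   := con 2 :* (con 1 :+ l) :+ (a :+ b :+ p)) refl

  invB-negate-extreme : ∀ pre post → All Small pre →
    invB (pre ++ -[1+ m ] ∷ post) ≡ suc (2 * length pre + invB (pre ++ ⁺ suc m ∷ post))
  invB-negate-extreme pre post spre
    rewrite pairInv-negate-extreme pre post spre
          | count-replace (λ x → x <ᵇ ⁺ 0) pre post { -[1+ m ]} {⁺ suc m} refl (>⇒<ᵇ-false (+<+ (z<s {m})))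
    = trans (ℕP.+-suc _ _) (cong suc (ℕP.+-assoc (2 * length pre) _ _))

  parity-negate-extreme : ∀ {e} pre rest → ∣ e ∣ ≡ suc m → All Small pre →
    evenᵇ (invB (pre ++ - e ∷ rest)) ≡ not (evenᵇ (invB (pre ++ e ∷ rest)))
  parity-negate-extreme {⁺ _} pre rest refl spre =
    trans (cong evenᵇ (invB-negate-extreme pre rest spre)) (evenᵇ-1+2*+ (length pre) _)
  parity-negate-extreme { -[1+ k ]} pre rest refl spre = begin
    evenᵇ (invB (pre ++ ⁺ suc m ∷ rest))
      ≡⟨ not-involutive _ ⟨
    not (not (evenᵇ (invB (pre ++ ⁺ suc m ∷ rest))))
      ≡⟨ cong not (trans (cong evenᵇ (invB-negate-extreme pre rest spre)) (evenᵇ-1+2*+ (length pre) _)) ⟨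
    not (evenᵇ (invB (pre ++ -[1+ m ] ∷ rest))) ∎
    where open ≡-Reasoning

  desW-negate-extreme : ∀ x pre y post → Small x → All Small pre → Small y →
    desW (x ∷ pre ++ -[1+ m ] ∷ y ∷ post) ≡ desW (x ∷ pre ++ ⁺ suc m ∷ y ∷ post)
  desW-negate-extreme x [] y post sx [] sy
    rewrite <⇒<ᵇ-true (-[1+m]<small x sx) | >⇒<ᵇ-false (-[1+m]<small y sy)
          | >⇒<ᵇ-false (small<+[1+m] x sx) | <⇒<ᵇ-true (small<+[1+m] y sy) = refl
  desW-negate-extreme x (p ∷ pre) y post sx (sp ∷ spre) sy =
    cong ((if p <ᵇ x then 1 else 0) +_) (desW-negate-extreme p pre y post sp spre sy)

  ascW-negate-extreme : ∀ x pre y post → Small x → All Small pre → Small y →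
    ascW (x ∷ pre ++ -[1+ m ] ∷ y ∷ post) ≡ ascW (x ∷ pre ++ ⁺ suc m ∷ y ∷ post)
  ascW-negate-extreme x [] y post sx [] sy
    rewrite >⇒<ᵇ-false (-[1+m]<small x sx) | <⇒<ᵇ-true (-[1+m]<small y sy)
          | <⇒<ᵇ-true (small<+[1+m] x sx) | >⇒<ᵇ-false (small<+[1+m] y sy) = refl
  ascW-negate-extreme x (p ∷ pre) y post sx (sp ∷ spre) sy =
    cong ((if x <ᵇ p then 1 else 0) +_) (ascW-negate-extreme p pre y post sp spre sy)

  desB-negate-extreme : ∀ {e} pre y post → ∣ e ∣ ≡ suc m → All Small pre → Small y →
    desB (pre ++ - e ∷ y ∷ post) ≡ desB (pre ++ e ∷ y ∷ post)
  desB-negate-extreme {⁺ _} pre y post refl spre sy = desW-negate-extreme (⁺ 0) pre y post z≤n spre sy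
  desB-negate-extreme { -[1+ _ ]} pre y post refl spre sy = sym (desW-negate-extreme (⁺ 0) pre y post z≤n spre sy)

  ascB-negate-extreme : ∀ {e} pre y post → ∣ e ∣ ≡ suc m → All Small pre → Small y →
    ascB (pre ++ - e ∷ y ∷ post) ≡ ascB (pre ++ e ∷ y ∷ post)
  ascB-negate-extreme {⁺ _} pre y post refl spre sy = ascW-negate-extreme (⁺ 0) pre y post z≤n spre sy
  ascB-negate-extreme { -[1+ _ ]} pre y post refl spre sy = sym (ascW-negate-extreme (⁺ 0) pre y post z≤n spre sy)

isSignedPerm : List ℤ → Bool
isSignedPerm w = distinctᵇ (map ∣_∣ w)

gfTerm : (List ℤ → Bool) → ℕ → ℕ → List ℤ → ℕ
gfTerm φ i j π = (if φ π then monomial (desB π) (ascB π) else zeroP) i j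

coeff-desAscGF : ∀ φ S i j → desAscGF φ S i j ≡ ∑ S (gfTerm φ i j)
coeff-desAscGF φ [] i j = refl
coeff-desAscGF φ (π ∷ S) i j = cong (gfTerm φ i j π +_) (coeff-desAscGF φ S i j)

coeff-desAscGF-B : ∀ φ n i j →
  desAscGF φ (B n) i j ≡ ∑ (words (signedValues n) n) (λ w → if isSignedPerm w then gfTerm φ i j w else 0)
coeff-desAscGF-B φ n i j =
  trans (coeff-desAscGF φ (B n) i j) (∑-filterᵇ isSignedPerm (words (signedValues n) n) (gfTerm φ i j))

gfTerm-false : ∀ φ i j π → φ π ≡ false → gfTerm φ i j π ≡ 0
gfTerm-false φ i j π φπ rewrite φπ = refl

gfTerm-plus≡gfTerm-minus : ∀ n i j π₁ π₂ → evenᵇ (invB π₁) ≡ not (evenᵇ (invB π₂)) →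
  pos n π₁ ≡ pos n π₂ → desB π₁ ≡ desB π₂ → ascB π₁ ≡ ascB π₂ →
  gfTerm (plusCond n) i j π₁ ≡ gfTerm (minusCond n) i j π₂
gfTerm-plus≡gfTerm-minus n i j π₁ π₂ parity pos-eq des-eq asc-eq
  rewrite parity | pos-eq | des-eq | asc-eq = refl

gfTerm-allCond : ∀ n i j π →
  gfTerm (allCond n) i j π ≡ gfTerm (plusCond n) i j π + gfTerm (minusCond n) i j π
gfTerm-allCond n i j π with evenᵇ (invB π) | pos n π ≡ᵇ n
... | true | true = refl
... | true | false = sym (ℕP.+-identityʳ _)
... | false | true = refl
... | false | false = refl

coeff-allCond : ∀ n S i j →
  desAscGF (allCond n) S i j ≡ desAscGF (plusCond n) S i j + desAscGF (minusCond n) S i j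
coeff-allCond n [] i j = refl
coeff-allCond n (π ∷ S) i j =
  trans (cong₂ _+_ (gfTerm-allCond n i j π) (coeff-allCond n S i j))
    (interchange (gfTerm (plusCond n) i j π) (gfTerm (minusCond n) i j π)
                 (desAscGF (plusCond n) S i j) (desAscGF (minusCond n) S i j))

module NegateMax (m : ℕ) where
  open ExtremeLetter m

  n : ℕ
  n = suc m

  IsMax : ℤ → Set
  IsMax x = (∣ x ∣ ≡ᵇ n) ≡ true

  NotMax : ℤ → Set
  NotMax x = (∣ x ∣ ≡ᵇ n) ≡ false

  Letter : ℤ → Set
  Letter x = ∣ x ∣ ∈[1, n ]

  negateMax : ℤ → ℤ
  negateMax x = if ∣ x ∣ ≡ᵇ n then - x else x

  ∣negateMax∣ : ∀ x → ∣ negateMax x ∣ ≡ ∣ x ∣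
  ∣negateMax∣ x with ∣ x ∣ ≡ᵇ n
  ... | true = ℤP.∣-i∣≡∣i∣ x
  ... | false = refl

  isSignedPerm-negateMax : ∀ π → isSignedPerm (map negateMax π) ≡ isSignedPerm π
  isSignedPerm-negateMax π = cong distinctᵇ (trans (sym (map-∘ π)) (map-cong ∣negateMax∣ π))

  posAux-negateMax : ∀ k π → posAux n k (map negateMax π) ≡ posAux n k π
  posAux-negateMax k [] = refl
  posAux-negateMax k (x ∷ π) rewrite ∣negateMax∣ x with ∣ x ∣ ≡ᵇ n
  ... | true = refl
  ... | false = posAux-negateMax (suc k) π

  negateMax-notMax : ∀ {x} → NotMax x → negateMax x ≡ x
  negateMax-notMax x≠n rewrite x≠n = refl

  negateMax-max : ∀ {x} → IsMax x → negateMax x ≡ - x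
  negateMax-max x=n rewrite x=n = refl

  ∑-signedValues-negateMax : ∀ (H : ℤ → ℕ) → ∑ (signedValues n) (H ∘ negateMax) ≡ ∑ (signedValues n) H
  ∑-signedValues-negateMax H = trans (∑-concatMap (upTo n) pair (H ∘ negateMax))
    (trans (∑-cong (upTo n) swap) (sym (∑-concatMap (upTo n) pair H)))
    where
    pair : ℕ → List ℤ
    pair i = ⁺ suc i ∷ -[1+ i ] ∷ []
    swap : ∀ i → ∑ (pair i) (H ∘ negateMax) ≡ ∑ (pair i) H
    swap i with suc i ≡ᵇ n
    ... | true rewrite ℕP.+-identityʳ (H (⁺ suc i)) | ℕP.+-identityʳ (H -[1+ i ]) =
      ℕP.+-comm (H -[1+ i ]) (H (⁺ suc i))
    ... | false = refl

  letters-signedValues : All Letter (signedValues n)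
  letters-signedValues = concat⁺ (map⁺ (applyUpTo⁺₁ id n (λ i<n → (s≤s z≤n , i<n) ∷ (s≤s z≤n , i<n) ∷ [])))

  letters-below-max : ∀ {xs} → All Letter xs → All NotMax xs → All (λ x → ∣ x ∣ ∈[1, m ]) xs
  letters-below-max ls nms =
    All.zipWith (λ ((1≤x , x≤n) , x≠n) → 1≤x , ℕP.≤-pred (ℕP.≤∧≢⇒< x≤n (≡ᵇ-false⇒≢ x≠n))) (ls , nms)

  data MaxView : List ℤ → Set where
    no-max : ∀ {π} → All NotMax π → MaxView π
    first-max : ∀ pre {e} post → All NotMax pre → IsMax e → MaxView (pre ++ e ∷ post)

  maxView : ∀ π → MaxView π
  maxView [] = no-max []
  maxView (x ∷ π) with ∣ x ∣ ≡ᵇ n in x≟n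
  ... | true = first-max [] π [] x≟n
  ... | false with maxView π
  ...   | no-max nms = no-max (x≟n ∷ nms)
  ...   | first-max pre post nms e-max = first-max (x ∷ pre) post (x≟n ∷ nms) e-max

  posAux-first-max : ∀ k pre {e} post → All NotMax pre → IsMax e → posAux n k (pre ++ e ∷ post) ≡ k + length pre
  posAux-first-max k [] post [] e-max rewrite e-max = sym (ℕP.+-identityʳ k)
  posAux-first-max k (x ∷ pre) post (x≠n ∷ nms) e-max rewrite x≠n =
    trans (posAux-first-max (suc k) pre post nms e-max) (sym (ℕP.+-suc k _))

  signedPerm-has-max : ∀ π → All Letter π → length π ≡ n → isSignedPerm π ≡ true → ¬ All NotMax π
  signedPerm-has-max π ls |π| dist nms = ℕP.n≮n m
    (subst (_≤ m) (trans (length-map ∣_∣ π) |π|)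
      (distinct-length-≤ m (map ∣_∣ π) dist (map⁺ (letters-below-max ls nms))))

  notMax-after-max : ∀ pre {e} rest → IsMax e → isSignedPerm (pre ++ e ∷ rest) ≡ true → All NotMax rest
  notMax-after-max pre {e} rest e-max dist = notMax-of-∉ rest n∉rest
    where
    notMax-of-∉ : ∀ xs → elemᵇ n (map ∣_∣ xs) ≡ false → All NotMax xs
    notMax-of-∉ [] _ = []
    notMax-of-∉ (y ∷ ys) n∉ with n ≡ᵇ ∣ y ∣ in n≟y
    notMax-of-∉ (y ∷ ys) () | true
    ... | false = ≢⇒≡ᵇ-false {∣ y ∣} {n} (λ y≡n → ≡ᵇ-false⇒≢ {n} {∣ y ∣} n≟y (sym y≡n)) ∷ notMax-of-∉ ys n∉
    n∉rest : elemᵇ n (map ∣_∣ rest) ≡ false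
    n∉rest = subst (λ z → elemᵇ z (map ∣_∣ rest) ≡ false) (≡ᵇ-true⇒≡ e-max)
      (distinctᵇ-after (map ∣_∣ pre) ∣ e ∣ (map ∣_∣ rest)
        (trans (cong distinctᵇ (sym (map-++ ∣_∣ pre (e ∷ rest)))) dist))

  gfTerm-negateMax-last : ∀ i j pre {e} → All NotMax pre → IsMax e → length (pre ++ e ∷ []) ≡ n →
    gfTerm (plusCond n) i j (map negateMax (pre ++ e ∷ [])) ≡ gfTerm (minusCond n) i j (pre ++ e ∷ [])
  gfTerm-negateMax-last i j pre {e} nms e-max |π| =
    trans (gfTerm-false (plusCond n) i j (map negateMax π) plus-at-n)
          (sym (gfTerm-false (minusCond n) i j π minus-at-n))
    where
    π = pre ++ e ∷ []
    pos≡n : pos n π ≡ n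
    pos≡n = begin
      posAux n 1 π          ≡⟨ posAux-first-max 1 pre [] nms e-max ⟩
      1 + length pre        ≡⟨ ℕP.+-comm 1 (length pre) ⟩
      length pre + 1        ≡⟨ length-++ pre ⟨
      length π              ≡⟨ |π| ⟩
      n                     ∎
      where open ≡-Reasoning
    plus-at-n : plusCond n (map negateMax π) ≡ false
    plus-at-n rewrite posAux-negateMax 1 π | ≡⇒≡ᵇ-true pos≡n = ∧-zeroʳ _
    minus-at-n : minusCond n π ≡ false
    minus-at-n rewrite ≡⇒≡ᵇ-true pos≡n = ∧-zeroʳ _

  gfTerm-negateMax-inner : ∀ i j pre {e} y post → All NotMax pre → All Small pre → IsMax e →
    All NotMax (y ∷ post) → Small y →
    gfTerm (plusCond n) i j (map negateMax (pre ++ e ∷ y ∷ post))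
      ≡ gfTerm (minusCond n) i j (pre ++ e ∷ y ∷ post)
  gfTerm-negateMax-inner i j pre {e} y post nms spre e-max nms-rest sy =
    gfTerm-plus≡gfTerm-minus n i j (map negateMax π) π
      (trans (cong (evenᵇ ∘ invB) negated) (parity-negate-extreme pre (y ∷ post) ∣e∣≡n spre))
      (posAux-negateMax 1 π)
      (trans (cong desB negated) (desB-negate-extreme pre y post ∣e∣≡n spre sy))
      (trans (cong ascB negated) (ascB-negate-extreme pre y post ∣e∣≡n spre sy))
    where
    π = pre ++ e ∷ y ∷ post
    ∣e∣≡n : ∣ e ∣ ≡ n
    ∣e∣≡n = ≡ᵇ-true⇒≡ e-max
    fixed : ∀ {xs} → All NotMax xs → map negateMax xs ≡ xs
    fixed {xs} nms = trans (map-cong-local (All.map negateMax-notMax nms)) (map-id xs)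
    negated : map negateMax π ≡ pre ++ - e ∷ y ∷ post
    negated = trans (map-++ negateMax pre (e ∷ y ∷ post))
      (cong₂ _++_ (fixed nms) (cong₂ _∷_ (negateMax-max e-max) (fixed nms-rest)))

  gfTerm-negateMax : ∀ i j π → All Letter π → length π ≡ n → isSignedPerm π ≡ true →
    gfTerm (plusCond n) i j (map negateMax π) ≡ gfTerm (minusCond n) i j π
  gfTerm-negateMax i j π ls |π| dist with maxView π
  ... | no-max nms = ⊥-elim (signedPerm-has-max π ls |π| dist nms)
  ... | first-max pre [] nms e-max = gfTerm-negateMax-last i j pre nms e-max |π|
  ... | first-max pre (y ∷ post) nms e-max =
    gfTerm-negateMax-inner i j pre y post nms (small (++⁻ˡ pre ls) nms) e-max nms-rest
      (All.head (small (All.tail (++⁻ʳ pre ls)) nms-rest))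
    where
    nms-rest = notMax-after-max pre (y ∷ post) e-max dist
    small : ∀ {xs} → All Letter xs → All NotMax xs → All Small xs
    small ls′ nms′ = All.map proj₂ (letters-below-max ls′ nms′)

  coeff-plus≡minus : desAscGF (plusCond n) (B n) ≈P desAscGF (minusCond n) (B n)
  coeff-plus≡minus i j = begin
    desAscGF (plusCond n) (B n) i j
      ≡⟨ coeff-desAscGF-B (plusCond n) n i j ⟩
    ∑ W (restrict (plusCond n))
      ≡⟨ ∑-words-map (signedValues n) negateMax ∑-signedValues-negateMax n (restrict (plusCond n)) ⟨
    ∑ W (restrict (plusCond n) ∘ map negateMax)
      ≡⟨ ∑-words-cong (signedValues n) letters-signedValues n pointwise ⟩
    ∑ W (restrict (minusCond n))
      ≡⟨ coeff-desAscGF-B (minusCond n) n i j ⟨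
    desAscGF (minusCond n) (B n) i j ∎
    where
    open ≡-Reasoning
    W = words (signedValues n) n
    restrict : (List ℤ → Bool) → List ℤ → ℕ
    restrict φ w = if isSignedPerm w then gfTerm φ i j w else 0
    pointwise : ∀ w → All Letter w → length w ≡ n →
      restrict (plusCond n) (map negateMax w) ≡ restrict (minusCond n) w
    pointwise w ls |w| rewrite isSignedPerm-negateMax w with isSignedPerm w in dist
    ... | true = gfTerm-negateMax i j w ls |w| dist
    ... | false = refl

corollary27 : (n : ℕ) → 1 ≤ n →
    (desAscGF (plusCond n) (B n) ≈P desAscGF (minusCond n) (B n))
    × (2 · desAscGF (minusCond n) (B n) ≈P desAscGF (allCond n) (B n))
corollary27 (suc m) _ = coeff-plus≡minus , twice-minus≡all
  where
  open NegateMax m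
  twice-minus≡all : 2 · desAscGF (minusCond n) (B n) ≈P desAscGF (allCond n) (B n)
  twice-minus≡all i j = begin
    2 * desAscGF (minusCond n) (B n) i j
      ≡⟨ cong (desAscGF (minusCond n) (B n) i j +_) (ℕP.+-identityʳ _) ⟩
    desAscGF (minusCond n) (B n) i j + desAscGF (minusCond n) (B n) i j
      ≡⟨ cong (_+ desAscGF (minusCond n) (B n) i j) (coeff-plus≡minus i j) ⟨
    desAscGF (plusCond n) (B n) i j + desAscGF (minusCond n) (B n) i j
      ≡⟨ coeff-allCond n (B n) i j ⟨
    desAscGF (allCond n) (B n) i j ∎
    where open ≡-Reasoning
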